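{- Let $\mathbb T$ be the theory of bounded distributive lattices (or of $\sigma$-frames) and let $A$ be a quasi-coherent $\mathbb I$-algebra. Then the observational preorder and the satisfaction order on $\operatorname{Spec}A$ coincide: for all $x,y:\operatorname{Spec}A$, $x\preceq_{\operatorname{Spec}A}y$ iff $\forall a:A.\ x(a)\le_{\mathbb I}y(a)$.
   Context: We work in intensional type theory with function extensionality. $\mathbb I$ is a model of $\mathbb T$; an $\mathbb I$-algebra is a $\mathbb T$-model with a homomorphism from $\mathbb I$. $\operatorname{Spec}A:=\mathbb I\text{ - }\mathbf{Alg}(A,\mathbb I)$; $\mathcal O X:=\mathbb I^X$ with pointwise operations. $A$ is quasi-coherent if $\iota_A:A\to\mathcal O\operatorname{Spec}A$, $a\mapsto(x\mapsto x(a))$, is an isomorphism of $\mathbb I$-algebras. $\le_{\mathbb I}$ is the lattice order on $\mathbb I$. For any type $X$, the observational preorder is $x\preceq_X y:\Leftrightarrow\forall U:\mathcal O X.\ U(x)\le_{\mathbb I}U(y)$. The satisfaction order on $\operatorname{Spec}A$ is $x\sqsubseteq y:\Leftrightarrow\forall a:A.\ x(a)\le_{\mathbb I}y(a)$. -}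

module Defs where

open import Level using (Level; _⊔_) renaming (suc to lsuc)
open import Data.Nat using (ℕ)
open import Relation.Binary.PropositionalEquality using (_≡_)
open import Algebra.Core using (Op₂)
open import Algebra.Definitions using (LeftIdentity; RightIdentity)
open import Algebra.Lattice.Structures using (IsDistributiveLattice; IsBoundedMeetSemilattice)

module BDLTheory where

  record BDL (ℓ : Level) : Set (lsuc ℓ) where
    infixr 7 _∧_
    infixr 6 _∨_
    field
      Carrier : Set ℓ
      ⊤ ⊥     : Carrier
      _∧_ _∨_ : Op₂ Carrier
      isDistributiveLattice : IsDistributiveLattice _≡_ _∨_ _∧_
      ∧-identityˡ : LeftIdentity _≡_ ⊤ _∧_
      ∧-identityʳ : RightIdentity _≡_ ⊤ _∧_
      ∨-identityˡ : LeftIdentity _≡_ ⊥ _∨_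
      ∨-identityʳ : RightIdentity _≡_ ⊥ _∨_

    _≤_ : Carrier → Carrier → Set ℓ
    x ≤ y = x ∧ y ≡ x

  open BDL

  record IsBDLHom {ℓ ℓ'} (L : BDL ℓ) (M : BDL ℓ') (f : Carrier L → Carrier M) : Set (ℓ ⊔ ℓ') where
    field
      pres-⊤ : f (⊤ L) ≡ ⊤ M
      pres-⊥ : f (⊥ L) ≡ ⊥ M
      pres-∧ : ∀ a b → f (_∧_ L a b) ≡ _∧_ M (f a) (f b)
      pres-∨ : ∀ a b → f (_∨_ L a b) ≡ _∨_ M (f a) (f b)

  record BDLAlg {ℓi} (𝕀 : BDL ℓi) (ℓ : Level) : Set (ℓi ⊔ lsuc ℓ) where
    field
      model : BDL ℓ
      η     : Carrier 𝕀 → Carrier model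
      η-hom : IsBDLHom 𝕀 model η

  open BDLAlg

  record BDLSpec {ℓi ℓ} {𝕀 : BDL ℓi} (A : BDLAlg 𝕀 ℓ) : Set (ℓi ⊔ ℓ) where
    field
      point     : Carrier (model A) → Carrier 𝕀
      point-hom : IsBDLHom (model A) 𝕀 point
      point-η   : ∀ i → point (η A i) ≡ i

  open BDLSpec

  BDL-ι : ∀ {ℓi ℓ} {𝕀 : BDL ℓi} (A : BDLAlg 𝕀 ℓ) → Carrier (model A) → (BDLSpec A → Carrier 𝕀)
  BDL-ι A a x = point x a

  -- A is quasi-coherent: ι_A is an isomorphism of 𝕀-algebras, where
  -- 𝒪 Spec A = 𝕀^(Spec A) carries the pointwise operations and the
  -- structure map i ↦ (x ↦ i).
  record BDLQuasiCoherent {ℓi ℓ} {𝕀 : BDL ℓi} (A : BDLAlg 𝕀 ℓ) : Set (ℓi ⊔ ℓ) where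
    private
      ι = BDL-ι A
      _∧A_ = _∧_ (model A)
      _∨A_ = _∨_ (model A)
      _∧I_ = _∧_ 𝕀
      _∨I_ = _∨_ 𝕀
    field
      ι-pres-⊤ : ι (⊤ (model A)) ≡ (λ x → ⊤ 𝕀)
      ι-pres-⊥ : ι (⊥ (model A)) ≡ (λ x → ⊥ 𝕀)
      ι-pres-∧ : ∀ a b → ι (a ∧A b) ≡ (λ x → ι a x ∧I ι b x)
      ι-pres-∨ : ∀ a b → ι (a ∨A b) ≡ (λ x → ι a x ∨I ι b x)
      ι-pres-η : ∀ i → ι (η A i) ≡ (λ x → i)
      ι⁻¹      : (BDLSpec A → Carrier 𝕀) → Carrier (model A)
      ι⁻¹∘ι    : ∀ a → ι⁻¹ (ι a) ≡ a
      ι∘ι⁻¹    : ∀ U → ι (ι⁻¹ U) ≡ U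

  -- observational preorder on a type X (with 𝒪 X = X → 𝕀)
  BDL-obs : ∀ {ℓi ℓ} (𝕀 : BDL ℓi) {X : Set ℓ} → X → X → Set (ℓi ⊔ ℓ)
  BDL-obs 𝕀 {X} x y = ∀ (U : X → Carrier 𝕀) → _≤_ 𝕀 (U x) (U y)


open BDLTheory public

module SFTheory where

  record SigmaFrame (ℓ : Level) : Set (lsuc ℓ) where
    infixr 7 _∧_
    field
      Carrier : Set ℓ
      ⊤ ⊥     : Carrier
      _∧_     : Op₂ Carrier
      ⋁       : (ℕ → Carrier) → Carrier
      isBoundedMeetSemilattice : IsBoundedMeetSemilattice _≡_ _∧_ ⊤

    _≤_ : Carrier → Carrier → Set ℓ
    x ≤ y = x ∧ y ≡ x

    field
      ⊥-least  : ∀ x → ⊥ ≤ x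
      ⋁-upper  : ∀ (s : ℕ → Carrier) n → s n ≤ ⋁ s
      ⋁-least  : ∀ (s : ℕ → Carrier) x → (∀ n → s n ≤ x) → ⋁ s ≤ x
      ⋁-distrib : ∀ x (s : ℕ → Carrier) → x ∧ ⋁ s ≡ ⋁ (λ n → x ∧ s n)

  open SigmaFrame

  record IsSFHom {ℓ ℓ'} (L : SigmaFrame ℓ) (M : SigmaFrame ℓ') (f : Carrier L → Carrier M) : Set (ℓ ⊔ ℓ') where
    field
      pres-⊤ : f (⊤ L) ≡ ⊤ M
      pres-⊥ : f (⊥ L) ≡ ⊥ M
      pres-∧ : ∀ a b → f (_∧_ L a b) ≡ _∧_ M (f a) (f b)
      pres-⋁ : ∀ (s : ℕ → Carrier L) → f (⋁ L s) ≡ ⋁ M (λ n → f (s n))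

  record SFAlg {ℓi} (𝕀 : SigmaFrame ℓi) (ℓ : Level) : Set (ℓi ⊔ lsuc ℓ) where
    field
      model : SigmaFrame ℓ
      η     : Carrier 𝕀 → Carrier model
      η-hom : IsSFHom 𝕀 model η

  open SFAlg

  record SFSpec {ℓi ℓ} {𝕀 : SigmaFrame ℓi} (A : SFAlg 𝕀 ℓ) : Set (ℓi ⊔ ℓ) where
    field
      point     : Carrier (model A) → Carrier 𝕀
      point-hom : IsSFHom (model A) 𝕀 point
      point-η   : ∀ i → point (η A i) ≡ i

  open SFSpec

  SF-ι : ∀ {ℓi ℓ} {𝕀 : SigmaFrame ℓi} (A : SFAlg 𝕀 ℓ) → Carrier (model A) → (SFSpec A → Carrier 𝕀)
  SF-ι A a x = point x a

  record SFQuasiCoherent {ℓi ℓ} {𝕀 : SigmaFrame ℓi} (A : SFAlg 𝕀 ℓ) : Set (ℓi ⊔ ℓ) where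
    private
      ι = SF-ι A
      _∧A_ = _∧_ (model A)
      _∧I_ = _∧_ 𝕀
    field
      ι-pres-⊤ : ι (⊤ (model A)) ≡ (λ x → ⊤ 𝕀)
      ι-pres-⊥ : ι (⊥ (model A)) ≡ (λ x → ⊥ 𝕀)
      ι-pres-∧ : ∀ a b → ι (a ∧A b) ≡ (λ x → ι a x ∧I ι b x)
      ι-pres-⋁ : ∀ (s : ℕ → Carrier (model A)) → ι (⋁ (model A) s) ≡ (λ x → ⋁ 𝕀 (λ n → ι (s n) x))
      ι-pres-η : ∀ i → ι (η A i) ≡ (λ x → i)
      ι⁻¹      : (SFSpec A → Carrier 𝕀) → Carrier (model A)
      ι⁻¹∘ι    : ∀ a → ι⁻¹ (ι a) ≡ a
      ι∘ι⁻¹    : ∀ U → ι (ι⁻¹ U) ≡ U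

  SF-obs : ∀ {ℓi ℓ} (𝕀 : SigmaFrame ℓi) {X : Set ℓ} → X → X → Set (ℓi ⊔ ℓ)
  SF-obs 𝕀 {X} x y = ∀ (U : X → Carrier 𝕀) → _≤_ 𝕀 (U x) (U y)

open SFTheory public

module Submission where

open import Defs
open import Level using (Level)
open import Data.Product using (_×_; _,_)
open import Function.Bundles using (_⇔_; mk⇔)
open import Relation.Binary.PropositionalEquality using (_≡_; cong-app; subst₂)

-- Observing through all maps X → I is the same as observing through the
-- basic opens `basic a`, as soon as every map X → I is a basic open.
observe-all⇔observe-basic : ∀ {a b c r} {A : Set a} {X : Set b} {I : Set c}
  (_≤_ : I → I → Set r) (basic : A → X → I) (code : (X → I) → A) →
  (∀ U → basic (code U) ≡ U) →
  ∀ x y → (∀ (U : X → I) → U x ≤ U y) ⇔ (∀ a → basic a x ≤ basic a y)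
observe-all⇔observe-basic _≤_ basic code basic∘code x y = mk⇔
  (λ obs a → obs (basic a))
  (λ sat U → subst₂ _≤_ (cong-app (basic∘code U) x) (cong-app (basic∘code U) y)
                        (sat (code U)))

BDL-obs⇔sat : ∀ {ℓi ℓ} (𝕀 : BDL ℓi) (A : BDLAlg 𝕀 ℓ) → BDLQuasiCoherent A →
  ∀ (x y : BDLSpec A) →
  BDL-obs 𝕀 x y ⇔ (∀ a → BDL._≤_ 𝕀 (BDLSpec.point x a) (BDLSpec.point y a))
BDL-obs⇔sat 𝕀 A qc = observe-all⇔observe-basic (BDL._≤_ 𝕀) (BDL-ι A) ι⁻¹ ι∘ι⁻¹
  where open BDLQuasiCoherent qc

SF-obs⇔sat : ∀ {ℓi ℓ} (𝕀 : SigmaFrame ℓi) (A : SFAlg 𝕀 ℓ) → SFQuasiCoherent A →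
  ∀ (x y : SFSpec A) →
  SF-obs 𝕀 x y ⇔ (∀ a → SigmaFrame._≤_ 𝕀 (SFSpec.point x a) (SFSpec.point y a))
SF-obs⇔sat 𝕀 A qc = observe-all⇔observe-basic (SigmaFrame._≤_ 𝕀) (SF-ι A) ι⁻¹ ι∘ι⁻¹
  where open SFQuasiCoherent qc

mainTheorem6 : ∀ {ℓi ℓ : Level} →
    (∀ (𝕀 : BDL ℓi) (A : BDLAlg 𝕀 ℓ) → BDLQuasiCoherent A →
      ∀ (x y : BDLSpec A) →
        BDL-obs 𝕀 x y ⇔ (∀ a → BDL._≤_ 𝕀 (BDLSpec.point x a) (BDLSpec.point y a)))
    ×
    (∀ (𝕀 : SigmaFrame ℓi) (A : SFAlg 𝕀 ℓ) → SFQuasiCoherent A →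
      ∀ (x y : SFSpec A) →
        SF-obs 𝕀 x y ⇔ (∀ a → SigmaFrame._≤_ 𝕀 (SFSpec.point x a) (SFSpec.point y a)))
mainTheorem6 = BDL-obs⇔sat , SF-obs⇔sat
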